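{- Let $\epsilon>0$, let $I^1$ be the rounded instance and let $t\in\Delta^m$ (notation in the context). If $\sigma^2$ is a schedule of the jobs on the $m$ machines such that $\sum_{j\in\sigma^2_i}p_{ij}\le(1+\epsilon)c_i$ for every machine $i$, where $p_{ij}$ and $c_i$ are those of $I^2(t)$, then $C^{I^1}_\Gamma(\sigma^2)\le(1+\epsilon)^2$.
   Context: Robust scheduling on identical machines: $n$ jobs, $m$ identical machines, a positive integer $\Gamma$, each job $j$ has nominal processing time $\overline p_j\ge0$ and deviation $\hat p_j\ge0$. For a schedule $\sigma$ and machine $i$ with job set $\sigma_i$, $\Gamma(\sigma_i)$ denotes a set of $\Gamma$ jobs of $\sigma_i$ with largest deviation (ties arbitrary; all of $\sigma_i$ if $|\sigma_i|<\Gamma$), $C_\Gamma(\sigma_i)=\sum_{j\in\sigma_i}\overline p_j+\sum_{j\in\Gamma(\sigma_i)}\hat p_j$ and $C_\Gamma(\sigma)=\max_iC_\Gamma(\sigma_i)$; $C^{I^1}_\Gamma$ denotes this cost computed with the deviations of $I^1$. Rounded instance $I^1$: same jobs, machines and nominal times; its deviations are $\hat p^1_j=0$ if $\hat p_j<\epsilon/\Gamma$, and otherwise the largest value of the form $\frac{\epsilon}{\Gamma}(1+\epsilon)^r$, $r\in\mathbb{Z}_{\ge0}$, not exceeding $\hat p_j$. Let $\Delta=\{0\}\cup\{\frac{\epsilon}{\Gamma}(1+\epsilon)^r: r\in\mathbb{Z}_{\ge0},\ \frac{\epsilon}{\Gamma}(1+\epsilon)^r\le\frac1\Gamma\}$.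 For $t\in\Delta^m$, the instance $I^2(t)$ (unrelated machines with capacities) has the same jobs and $m$ machines, machine $i$ having capacity $c_i=1-\Gamma t_i+\epsilon$ and processing times $p_{ij}=\overline p_j+\hat p^1_j-t_i$ if $\hat p^1_j\ge t_i$ and $p_{ij}=\overline p_j$ if $\hat p^1_j<t_i$.
   Formalization: The parameter ε is a positive rational, and the nominal processing times $\overline p_j$, the deviations $\hat p_j$ and the entries of t are rational as well. -}

module Defs where

open import Data.Nat as ℕ using (ℕ; zero; suc)
open import Data.Integer using (+_)
open import Data.Rational using (ℚ; 0ℚ; 1ℚ; _+_; _*_; _-_; _≤_; _<_; _/_)
open import Data.Fin using (Fin; zero; suc)
open import Data.Fin.Subset using (Subset; _∈_; _∉_; _⊆_; ∣_∣)
open import Data.Bool using (true; false)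
open import Data.Vec using (Vec; []; _∷_; tabulate)
open import Data.Product using (Σ; _×_; ∃)
open import Data.Sum using (_⊎_)
open import Relation.Binary.PropositionalEquality using (_≡_)
open import Relation.Nullary using (does)
import Data.Fin as Fin

_^_ : ℚ → ℕ → ℚ
x ^ zero = 1ℚ
x ^ suc r = x * (x ^ r)

_over_ : ℚ → (Γ : ℕ) → .{{_ : ℕ.NonZero Γ}} → ℚ
ε over Γ = ε * (+ 1 / Γ)

ℕ→ℚ : ℕ → ℚ
ℕ→ℚ k = + k / 1

sumOver : ∀ {n} → Subset n → (Fin n → ℚ) → ℚ
sumOver {zero} [] f = 0ℚ
sumOver {suc n} (true ∷ S) f = f zero + sumOver S (λ j → f (suc j))
sumOver {suc n} (false ∷ S) f = sumOver S (λ j → f (suc j))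

-- a schedule assigns each of the n jobs to one of the m machines;
-- σ_i is the set of jobs assigned to machine i
Schedule : ℕ → ℕ → Set
Schedule n m = Fin n → Fin m

jobsOn : ∀ {n m} → Schedule n m → Fin m → Subset n
jobsOn σ i = tabulate (λ j → does (σ j Fin.≟ i))

-- S is a valid choice of Γ(σ_i) w.r.t. deviations dev: a set of
-- min(Γ,|σ_i|) jobs of σ_i with largest deviation (ties arbitrary)
IsTopΓ : ∀ {n} → ℕ → (Fin n → ℚ) → Subset n → Subset n → Set
IsTopΓ Γ dev T S =
  S ⊆ T × ∣ S ∣ ≡ ℕ._⊓_ Γ ∣ T ∣ ×
  (∀ j k → j ∈ S → k ∈ T → k ∉ S → dev k ≤ dev j)

machineCost : ∀ {n} → (Fin n → ℚ) → (Fin n → ℚ) → Subset n → Subset n → ℚ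
machineCost pbar dev T S = sumOver T pbar + sumOver S dev

IsRounded : (ε : ℚ) (Γ : ℕ) .{{_ : ℕ.NonZero Γ}} → ℚ → ℚ → Set
IsRounded ε Γ p p1 =
  (p < ε over Γ × p1 ≡ 0ℚ) ⊎
  (ε over Γ ≤ p × Σ ℕ λ r →
     p1 ≡ (ε over Γ) * ((1ℚ + ε) ^ r) ×
     p1 ≤ p ×
     (∀ r′ → (ε over Γ) * ((1ℚ + ε) ^ r′) ≤ p → r′ ℕ.≤ r))

InΔ : (ε : ℚ) (Γ : ℕ) .{{_ : ℕ.NonZero Γ}} → ℚ → Set
InΔ ε Γ x =
  x ≡ 0ℚ ⊎
  (Σ ℕ λ r → x ≡ (ε over Γ) * ((1ℚ + ε) ^ r) × x ≤ 1ℚ over Γ)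

capacity : (ε : ℚ) (Γ : ℕ) → ℚ → ℚ
capacity ε Γ ti = (1ℚ - ℕ→ℚ Γ * ti) + ε

procTime : (pbar p1 ti : ℚ) → ℚ
procTime pbar p1 ti with does (ti Data.Rational.≤? p1)
... | true = (pbar + p1) - ti
... | false = pbar

{-# OPTIONS --safe #-}
-- On machine i every job j has p_ij ≥ p̄_j, and p_ij + tᵢ ≥ p̄_j + p̂¹_j.  Charging
-- each of the at most Γ jobs of Γ(σ²ᵢ) an extra tᵢ therefore bounds its cost by
-- Σ_j p_ij + Γ tᵢ ≤ (1 + ε)(1 − Γ tᵢ + ε) + Γ tᵢ = (1 + ε)² − ε Γ tᵢ.

module Submission where

open import Defs
open import Data.Nat as ℕ using (ℕ)
open import Data.Rational using (ℚ; 0ℚ; 1ℚ; _+_; _*_; _≤_; _<_)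
open import Data.Fin using (Fin)
open import Data.Fin.Subset using (Subset)

open import Data.Nat using (zero; suc)
import Data.Nat.Properties as ℕ
import Data.Nat.Coprimality as Coprimality
open import Data.Integer as ℤ using (+≤+)
import Data.Integer.Properties as ℤ
open import Data.Fin using (zero; suc)
open import Data.Fin.Subset using (_⊆_; ∣_∣)
open import Data.Fin.Subset.Properties using (drop-∷-⊆)
open import Data.Bool using (true; false)
open import Data.Vec using ([]; _∷_; here)
open import Data.Product using (_,_)
open import Data.Sum using (inj₁; inj₂)
open import Data.Rational using (mkℚ; *≤*; _-_; -_; _≤?_; nonNegative)
open import Data.Rational.Properties
open import Data.Rational.Solver using (module +-*-Solver)
open import Function using (_∘_)
open import Relation.Nullary using (yes; no; ¬_)
open import Relation.Nullary.Decidable using (dec-true; dec-false)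
open import Relation.Binary.PropositionalEquality using (_≡_; refl; sym; cong; subst; module ≡-Reasoning)

open +-*-Solver

interchange : ∀ a b c d → (a + b) + (c + d) ≡ (a + c) + (b + d)
interchange = solve 4 (λ a b c d → (a :+ b) :+ (c :+ d) := (a :+ c) :+ (b :+ d)) refl

-- ℕ→ℚ k normalises by gcd k 1, which does not reduce for a variable k.
ℕ→ℚ≡mkℚ : ∀ k → ℕ→ℚ k ≡ mkℚ (ℤ.+ k) 0 (Coprimality.sym (Coprimality.1-coprimeTo k))
ℕ→ℚ≡mkℚ k = normalize-coprime _

ℕ→ℚ-suc : ∀ k → ℕ→ℚ (suc k) ≡ 1ℚ + ℕ→ℚ k
ℕ→ℚ-suc k rewrite ℕ→ℚ≡mkℚ k | ℕ.*-identityʳ k | ℤ.+◃n≡+n k = refl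

ℕ→ℚ-mono-≤ : ∀ {k l} → k ℕ.≤ l → ℕ→ℚ k ≤ ℕ→ℚ l
ℕ→ℚ-mono-≤ {k} {l} k≤l rewrite ℕ→ℚ≡mkℚ k | ℕ→ℚ≡mkℚ l =
  *≤* (ℤ.*-monoʳ-≤-nonNeg (ℤ.+ 1) (+≤+ k≤l))

sumOver-const : ∀ {n} (S : Subset n) t → sumOver S (λ _ → t) ≡ ℕ→ℚ ∣ S ∣ * t
sumOver-const [] t = sym (*-zeroˡ t)
sumOver-const (false ∷ S) t = sumOver-const S t
sumOver-const (true ∷ S) t = begin
  t + sumOver S (λ _ → t)   ≡⟨ cong (t +_) (sumOver-const S t) ⟩
  t + ℕ→ℚ ∣ S ∣ * t         ≡⟨ solve 2 (λ k x → x :+ k :* x := (con 1ℚ :+ k) :* x) refl (ℕ→ℚ ∣ S ∣) t ⟩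
  (1ℚ + ℕ→ℚ ∣ S ∣) * t      ≡⟨ cong (_* t) (sym (ℕ→ℚ-suc ∣ S ∣)) ⟩
  ℕ→ℚ (suc ∣ S ∣) * t       ∎
  where open ≡-Reasoning

sumOver-⊆-mono : ∀ {n} (S T : Subset n) {f g h k : Fin n → ℚ} → S ⊆ T →
  (∀ j → f j ≤ g j) → (∀ j → f j + h j ≤ g j + k j) →
  sumOver T f + sumOver S h ≤ sumOver T g + sumOver S k
sumOver-⊆-mono [] [] _ _ _ = ≤-refl
sumOver-⊆-mono (true ∷ S) (false ∷ T) S⊆T _ _ with () ← S⊆T here
sumOver-⊆-mono (false ∷ S) (false ∷ T) S⊆T f≤g fh≤gk =
  sumOver-⊆-mono S T (drop-∷-⊆ S⊆T) (f≤g ∘ suc) (fh≤gk ∘ suc)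
sumOver-⊆-mono (false ∷ S) (true ∷ T) {f} {g} {h} {k} S⊆T f≤g fh≤gk = begin
  (f zero + sumOver T (f ∘ suc)) + sumOver S (h ∘ suc)   ≡⟨ +-assoc (f zero) _ _ ⟩
  f zero + (sumOver T (f ∘ suc) + sumOver S (h ∘ suc))   ≤⟨ +-mono-≤ (f≤g zero) (sumOver-⊆-mono S T (drop-∷-⊆ S⊆T) (f≤g ∘ suc) (fh≤gk ∘ suc)) ⟩
  g zero + (sumOver T (g ∘ suc) + sumOver S (k ∘ suc))   ≡⟨ +-assoc (g zero) _ _ ⟨
  (g zero + sumOver T (g ∘ suc)) + sumOver S (k ∘ suc)   ∎
  where open ≤-Reasoning
sumOver-⊆-mono (true ∷ S) (true ∷ T) {f} {g} {h} {k} S⊆T f≤g fh≤gk = begin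
  (f zero + sumOver T (f ∘ suc)) + (h zero + sumOver S (h ∘ suc))   ≡⟨ interchange (f zero) _ _ _ ⟩
  (f zero + h zero) + (sumOver T (f ∘ suc) + sumOver S (h ∘ suc))   ≤⟨ +-mono-≤ (fh≤gk zero) (sumOver-⊆-mono S T (drop-∷-⊆ S⊆T) (f≤g ∘ suc) (fh≤gk ∘ suc)) ⟩
  (g zero + k zero) + (sumOver T (g ∘ suc) + sumOver S (k ∘ suc))   ≡⟨ interchange (g zero) _ _ _ ⟨
  (g zero + sumOver T (g ∘ suc)) + (k zero + sumOver S (k ∘ suc))   ∎
  where open ≤-Reasoning

procTime-≤ : ∀ pb p1 t → t ≤ p1 → procTime pb p1 t ≡ (pb + p1) - t
procTime-≤ pb p1 t t≤p1 rewrite dec-true (t ≤? p1) t≤p1 = refl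

procTime-≰ : ∀ pb p1 t → ¬ t ≤ p1 → procTime pb p1 t ≡ pb
procTime-≰ pb p1 t t≰p1 rewrite dec-false (t ≤? p1) t≰p1 = refl

nominal≤procTime : ∀ pb p1 t → pb ≤ procTime pb p1 t
nominal≤procTime pb p1 t with t ≤? p1
... | yes t≤p1 = begin
  pb                 ≡⟨ solve 2 (λ a c → a := (a :+ c) :- c) refl pb t ⟩
  (pb + t) - t       ≤⟨ +-monoˡ-≤ (- t) (+-monoʳ-≤ pb t≤p1) ⟩
  (pb + p1) - t      ≡⟨ procTime-≤ pb p1 t t≤p1 ⟨
  procTime pb p1 t   ∎
  where open ≤-Reasoning
... | no t≰p1 = ≤-reflexive (sym (procTime-≰ pb p1 t t≰p1))

nominal+rounded≤procTime+t : ∀ pb p1 t → pb + p1 ≤ procTime pb p1 t + t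
nominal+rounded≤procTime+t pb p1 t with t ≤? p1
... | yes t≤p1 = ≤-reflexive (begin
  pb + p1                  ≡⟨ solve 3 (λ a b c → a :+ b := ((a :+ b) :- c) :+ c) refl pb p1 t ⟩
  ((pb + p1) - t) + t      ≡⟨ cong (_+ t) (procTime-≤ pb p1 t t≤p1) ⟨
  procTime pb p1 t + t     ∎)
  where open ≡-Reasoning
... | no t≰p1 = begin
  pb + p1                  ≤⟨ +-monoʳ-≤ pb (<⇒≤ (≰⇒> t≰p1)) ⟩
  pb + t                   ≡⟨ cong (_+ t) (procTime-≰ pb p1 t t≰p1) ⟨
  procTime pb p1 t + t     ∎
  where open ≤-Reasoning

0≤-* : ∀ {p q} → 0ℚ ≤ p → 0ℚ ≤ q → 0ℚ ≤ p * q
0≤-* {p} {q} 0≤p 0≤q =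
  nonNegative⁻¹ (p * q) {{nonNeg*nonNeg⇒nonNeg p {{nonNegative 0≤p}} q {{nonNegative 0≤q}}}}

0≤-^ : ∀ {x} → 0ℚ ≤ x → ∀ r → 0ℚ ≤ x ^ r
0≤-^ 0≤x zero = nonNegative⁻¹ 1ℚ
0≤-^ 0≤x (suc r) = 0≤-* 0≤x (0≤-^ 0≤x r)

0≤ℕ→ℚ : ∀ k → 0ℚ ≤ ℕ→ℚ k
0≤ℕ→ℚ k = nonNegative⁻¹ (ℕ→ℚ k) {{normalize-nonNeg k 1}}

InΔ-nonNeg : ∀ {ε Γ x} .{{_ : ℕ.NonZero Γ}} → 0ℚ ≤ ε → InΔ ε Γ x → 0ℚ ≤ x
InΔ-nonNeg _ (inj₁ refl) = ≤-refl
InΔ-nonNeg {ε} {Γ} 0≤ε (inj₂ (r , refl , _)) =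
  0≤-* (0≤-* 0≤ε (nonNegative⁻¹ _ {{normalize-nonNeg 1 Γ}}))
       (0≤-^ (+-mono-≤ (nonNegative⁻¹ 1ℚ) 0≤ε) r)

capacity-slack : ∀ ε Γ t → 0ℚ ≤ ε → 0ℚ ≤ t →
  (1ℚ + ε) * capacity ε Γ t + ℕ→ℚ Γ * t ≤ (1ℚ + ε) ^ 2
capacity-slack ε Γ t 0≤ε 0≤t = begin
  L            ≡⟨ +-identityʳ L ⟨
  L + 0ℚ       ≤⟨ +-monoʳ-≤ L (0≤-* 0≤ε (0≤-* (0≤ℕ→ℚ Γ) 0≤t)) ⟩
  L + ε * G    ≡⟨ solve 2 (λ e g → (con 1ℚ :+ e) :* ((con 1ℚ :- g) :+ e) :+ g :+ e :* g
                          := (con 1ℚ :+ e) :* ((con 1ℚ :+ e) :* con 1ℚ)) refl ε G ⟩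
  (1ℚ + ε) ^ 2 ∎
  where
  open ≤-Reasoning
  G L : ℚ
  G = ℕ→ℚ Γ * t
  L = (1ℚ + ε) * capacity ε Γ t + G

lemma4 : (n m Γ : ℕ) .{{_ : ℕ.NonZero Γ}} (ε : ℚ) → 0ℚ < ε →
    (pbar phat p1 : Fin n → ℚ) →
    (∀ j → 0ℚ ≤ pbar j) → (∀ j → 0ℚ ≤ phat j) →
    (∀ j → IsRounded ε Γ (phat j) (p1 j)) →
    (t : Fin m → ℚ) → (∀ i → InΔ ε Γ (t i)) →
    (σ : Schedule n m) →
    (∀ i → sumOver (jobsOn σ i) (λ j → procTime (pbar j) (p1 j) (t i))
             ≤ (1ℚ + ε) * capacity ε Γ (t i)) →
    ∀ i (S : Subset n) → IsTopΓ Γ p1 (jobsOn σ i) S →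
    machineCost pbar p1 (jobsOn σ i) S ≤ (1ℚ + ε) ^ 2
lemma4 n m Γ ε 0<ε pbar phat p1 _ _ _ t t∈Δ σ load i S (S⊆T , ∣S∣≡Γ⊓∣T∣ , _) = begin
  sumOver T pbar + sumOver S p1                   ≤⟨ sumOver-⊆-mono S T S⊆T
                                                       (λ j → nominal≤procTime (pbar j) (p1 j) tᵢ)
                                                       (λ j → nominal+rounded≤procTime+t (pbar j) (p1 j) tᵢ) ⟩
  sumOver T proc + sumOver S (λ _ → tᵢ)           ≡⟨ cong (sumOver T proc +_) (sumOver-const S tᵢ) ⟩
  sumOver T proc + ℕ→ℚ ∣ S ∣ * tᵢ                 ≤⟨ +-mono-≤ (load i) (*-monoʳ-≤-nonNeg tᵢ {{nonNegative 0≤tᵢ}} (ℕ→ℚ-mono-≤ ∣S∣≤Γ)) ⟩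
  (1ℚ + ε) * capacity ε Γ tᵢ + ℕ→ℚ Γ * tᵢ         ≤⟨ capacity-slack ε Γ tᵢ 0≤ε 0≤tᵢ ⟩
  (1ℚ + ε) ^ 2                                    ∎
  where
  open ≤-Reasoning
  T : Subset n
  T = jobsOn σ i
  tᵢ : ℚ
  tᵢ = t i
  proc : Fin n → ℚ
  proc j = procTime (pbar j) (p1 j) tᵢ
  0≤ε : 0ℚ ≤ ε
  0≤ε = <⇒≤ 0<ε
  0≤tᵢ : 0ℚ ≤ tᵢ
  0≤tᵢ = InΔ-nonNeg 0≤ε (t∈Δ i)
  ∣S∣≤Γ : ∣ S ∣ ℕ.≤ Γ
  ∣S∣≤Γ = subst (ℕ._≤ Γ) (sym ∣S∣≡Γ⊓∣T∣) (ℕ.m⊓n≤m Γ ∣ T ∣)
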